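{- Let $S$ be the set of $3$-partitions $\mu$ for which there is a positive integer $d$ with $\mu$ a partition of $6d$ and $a_\mu(d[6])>0$. Let $X=\{(6),(6,6),(8,4),(10,2),(6,6,6),(8,6,4),(10,4,4),(9,6,3),(8,8,2),(10,6,2),(11,5,2),(10,7,1),(12,4,2),(11,6,1),(10,8),(14,2,2),(13,4,1),(13,5),(15,3),(8,8,8),(10,8,6),(11,7,6),(10,9,5),(11,8,5),(10,10,4),(12,7,5),(11,9,4),(13,6,5),(12,8,4),(11,10,3),(13,7,4),(12,9,3),(13,8,3),(12,10,2),(15,5,4),(14,7,3),(13,9,2),(13,10,1),(16,5,3),(15,7,2),(14,9,1),(17,4,3),(15,8,1),(15,9),(19,3,2),(18,5,1),(17,7),(10,10,10),(11,10,9),(12,10,8),(13,9,8),(12,11,7),(13,10,7),(14,9,7),(13,11,6),(15,8,7),(13,12,5),(16,7,7),(15,9,6),(14,11,5),(13,13,4),(15,10,5),(15,11,4),(14,13,3),(16,11,3),(15,13,2),(15,14,1),(17,13),(13,12,11),(14,11,11),(13,13,10),(15,11,10),(14,13,9),(16,11,9),(15,13,8),(15,14,7),(18,9,9),(15,15,6),(17,17,2),(18,17,1),(26,5,5),(15,14,13),(16,13,13),(15,15,12),(17,17,8),(18,15,15),(17,17,14),(25,23),(45,45)\}$ (trailing zeros omitted). Then $X$ is the set of generators of the semigroup $S$ (under componentwise addition): $X\subseteq S$, and every element of $S$ is a finite sum of elements of $X$.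
   Context: A $3$-partition of $N$ is a nonincreasing triple of nonnegative integers summing to $N$; partitions are added componentwise. The plethysm coefficient $a_\mu(d[n])$ is the coefficient of the Schur function $s_\mu$ in $h_d[h_n]$, equivalently the multiplicity of the irreducible $\mathsf{GL}_3$-representation of highest weight $\mu$ in $\mathrm{Sym}^d(\mathrm{Sym}^n\mathbb{C}^3)$. -}

module Defs where

open import Data.Nat using (ℕ; zero; suc; _+_; _*_; _∸_; _≤_; _≤?_; _<_; _≟_)
open import Data.Integer as ℤ using (ℤ; +_)
open import Data.Product using (_×_; _,_; Σ; ∃; ∃-syntax)
open import Data.List using (List; []; _∷_; concatMap; map; upTo; foldr)
open import Data.List.Relation.Unary.All using (All)
open import Data.List.Membership.Propositional using (_∈_)
open import Relation.Nullary using (yes; no)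
open import Relation.Binary.PropositionalEquality using (_≡_)

-- Triples of natural numbers: exponent vectors of monomials in x₁,x₂,x₃,
-- i.e. GL₃-weights; also used for 3-partitions.
Triple : Set
Triple = ℕ × ℕ × ℕ

_⊕_ : Triple → Triple → Triple
(a , b , c) ⊕ (a' , b' , c') = (a + a' , b + b' , c + c')

infixl 6 _⊕_

size : Triple → ℕ
size (a , b , c) = a + b + c

IsPartition3 : Triple → Set
IsPartition3 (a , b , c) = (b ≤ a) × (c ≤ b)

-- all exponent vectors of monomials of degree n in three variables
-- (the weights of Sym^n ℂ³, i.e. the monomials of h_n(x₁,x₂,x₃))
monomials : ℕ → List Triple
monomials n = concatMap (λ a → map (λ b → (a , b , n ∸ a ∸ b)) (upTo (suc (n ∸ a)))) (upTo (suc n))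

_•_ : ℕ → Triple → Triple
k • (a , b , c) = (k * a , k * b , k * c)

_≤ᵀ?_ : Triple → Triple → Data.Nat.ℕ
(a , b , c) ≤ᵀ? (a' , b' , c') with a ≤? a' | b ≤? b' | c ≤? c'
... | yes _ | yes _ | yes _ = 1
... | _ | _ | _ = 0

_∸ᵀ_ : Triple → Triple → Triple
(a , b , c) ∸ᵀ (a' , b' , c') = (a ∸ a' , b ∸ b' , c ∸ c')

isZeroᵀ : Triple → ℕ
isZeroᵀ (zero , zero , zero) = 1
isZeroᵀ _ = 0

-- multisetCount ms d w = number of multisets of size d of elements of the
-- list ms (of distinct monomials) whose exponent vectors add up to w.
multisetCount : List Triple → ℕ → Triple → ℕ
multisetCount [] zero w = isZeroᵀ w
multisetCount [] (suc d) w = 0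
multisetCount (m ∷ ms) d w = go d
  where
  -- sum over the multiplicity k ∈ {0..j} of the monomial m
  go : ℕ → ℕ
  go zero = multisetCount ms d w
  go (suc j) = go j + ((suc j • m) ≤ᵀ? w) * multisetCount ms (d ∸ suc j) (w ∸ᵀ (suc j • m))
-- (go d sums over k = 0..d, so the truncated subtraction d ∸ k is exact.)

-- Coefficient of the monomial x^w in the symmetric polynomial h_d[h_n](x₁,x₂,x₃),
-- equivalently the dimension of the w-weight space of Sym^d(Sym^n ℂ³).
plethWeight : ℕ → ℕ → Triple → ℕ
plethWeight d n w = multisetCount (monomials n) d w

plethWeightℤ : ℕ → ℕ → ℤ → ℤ → ℤ → ℤ
plethWeightℤ d n (+ a) (+ b) (+ c) = + plethWeight d n (a , b , c)
plethWeightℤ d n _ _ _ = + 0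

-- Plethysm coefficient a_μ(d[n]) = coefficient of s_μ in h_d[h_n], computed in
-- three variables (valid since μ has at most 3 parts) by the bialternant
-- formula s_μ = a_{μ+δ}/a_δ, δ = (2,1,0):
--   a_μ(d[n]) = [x^{μ+δ}] (a_δ · h_d[h_n]) = Σ_{σ ∈ S₃} sgn(σ) [x^{μ+δ-σ(δ)}] h_d[h_n].
plethysmCoeff : ℕ → ℕ → Triple → ℤ
plethysmCoeff d n (a , b , c) =
  let A = + a ; B = + b ; C = + c
      P = plethWeightℤ d n
  in   P A B C                                           -- σδ = (2,1,0), +
     ℤ.- P (A ℤ.+ + 1) (B ℤ.- + 1) C                     -- σδ = (1,2,0), -
     ℤ.- P A (B ℤ.+ + 1) (C ℤ.- + 1)                     -- σδ = (2,0,1), -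
     ℤ.- P (A ℤ.+ + 2) B (C ℤ.- + 2)                     -- σδ = (0,1,2), -
     ℤ.+ P (A ℤ.+ + 1) (B ℤ.+ + 1) (C ℤ.- + 2)           -- σδ = (1,0,2), +
     ℤ.+ P (A ℤ.+ + 2) (B ℤ.- + 1) (C ℤ.- + 1)           -- σδ = (0,2,1), +

InS : Triple → Set
InS μ = IsPartition3 μ × ∃[ d ] (1 ≤ d × size μ ≡ 6 * d × (+ 0 ℤ.< plethysmCoeff d 6 μ))

sumT : List Triple → Triple
sumT = foldr _⊕_ (0 , 0 , 0)

X : List Triple
X = (6 , 0 , 0) ∷ (6 , 6 , 0) ∷ (8 , 4 , 0) ∷ (10 , 2 , 0) ∷ (6 , 6 , 6) ∷ (8 , 6 , 4) ∷
    (10 , 4 , 4) ∷ (9 , 6 , 3) ∷ (8 , 8 , 2) ∷ (10 , 6 , 2) ∷ (11 , 5 , 2) ∷ (10 , 7 , 1) ∷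
    (12 , 4 , 2) ∷ (11 , 6 , 1) ∷ (10 , 8 , 0) ∷ (14 , 2 , 2) ∷ (13 , 4 , 1) ∷ (13 , 5 , 0) ∷
    (15 , 3 , 0) ∷ (8 , 8 , 8) ∷ (10 , 8 , 6) ∷ (11 , 7 , 6) ∷ (10 , 9 , 5) ∷ (11 , 8 , 5) ∷
    (10 , 10 , 4) ∷ (12 , 7 , 5) ∷ (11 , 9 , 4) ∷ (13 , 6 , 5) ∷ (12 , 8 , 4) ∷ (11 , 10 , 3) ∷
    (13 , 7 , 4) ∷ (12 , 9 , 3) ∷ (13 , 8 , 3) ∷ (12 , 10 , 2) ∷ (15 , 5 , 4) ∷ (14 , 7 , 3) ∷
    (13 , 9 , 2) ∷ (13 , 10 , 1) ∷ (16 , 5 , 3) ∷ (15 , 7 , 2) ∷ (14 , 9 , 1) ∷ (17 , 4 , 3) ∷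
    (15 , 8 , 1) ∷ (15 , 9 , 0) ∷ (19 , 3 , 2) ∷ (18 , 5 , 1) ∷ (17 , 7 , 0) ∷ (10 , 10 , 10) ∷
    (11 , 10 , 9) ∷ (12 , 10 , 8) ∷ (13 , 9 , 8) ∷ (12 , 11 , 7) ∷ (13 , 10 , 7) ∷ (14 , 9 , 7) ∷
    (13 , 11 , 6) ∷ (15 , 8 , 7) ∷ (13 , 12 , 5) ∷ (16 , 7 , 7) ∷ (15 , 9 , 6) ∷ (14 , 11 , 5) ∷
    (13 , 13 , 4) ∷ (15 , 10 , 5) ∷ (15 , 11 , 4) ∷ (14 , 13 , 3) ∷ (16 , 11 , 3) ∷ (15 , 13 , 2) ∷
    (15 , 14 , 1) ∷ (17 , 13 , 0) ∷ (13 , 12 , 11) ∷ (14 , 11 , 11) ∷ (13 , 13 , 10) ∷ (15 , 11 , 10) ∷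
    (14 , 13 , 9) ∷ (16 , 11 , 9) ∷ (15 , 13 , 8) ∷ (15 , 14 , 7) ∷ (18 , 9 , 9) ∷ (15 , 15 , 6) ∷
    (17 , 17 , 2) ∷ (18 , 17 , 1) ∷ (26 , 5 , 5) ∷ (15 , 14 , 13) ∷ (16 , 13 , 13) ∷ (15 , 15 , 12) ∷
    (17 , 17 , 8) ∷ (18 , 15 , 15) ∷ (17 , 17 , 14) ∷ (25 , 23 , 0) ∷ (45 , 45 , 0) ∷ []

{-# OPTIONS --safe #-}
module Submission where

-- Write a 3-partition as ϖ (p , q , r) = p ϖ₁ + q ϖ₂ + r ϖ₃ with ϖ₁ = (1,0,0), ϖ₂ = (1,1,0),
-- ϖ₃ = (1,1,1); adding the generators (6), (6,6), (6,6,6) raises p, q, r by 6. Reducing p, q, r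
-- by multiples of 6 brings every μ ∈ S into the box p < 42, q < 46, r < 16, where a certificate
-- is checked by evaluation: every lattice point of the box lies above 0, a generator or
-- (18,11,1) by multiples of 6 in each ϖ-coordinate, or else it is "exceptional" and has
-- non-positive plethysm coefficient. Reductions in q or r never end at an exceptional point,
-- and reductions in p do so only when q + 2r ≤ 6 and p ≥ 36, where the stability
-- a_{μ+(n)}((d+1)[n]) = a_μ(d[n]) for (n-1)d ≤ μ₁ shows that the coefficient was already
-- non-positive. The coefficients are computed by a dynamic programme for the weight
-- multiplicities of Sym^d(Sym^n ℂ³).

open import Defs
open import Data.Bool as Bool using (Bool; T; _∧_; _∨_; if_then_else_)
open import Data.Bool.ListAction using (any; all)
open import Data.Bool.Properties using (T-∧; T-∨; T-≡)
open import Data.Empty using (⊥-elim)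
open import Data.Fin as Fin using (toℕ; fromℕ)
open import Data.Fin.Properties using (toℕ-fromℕ)
open import Data.Integer as ℤ using (ℤ; +_; -[1+_])
import Data.Integer.Properties as ℤ
open import Data.List using (List; []; _∷_; _++_; [_]; map; concatMap; replicate; take; upTo)
open import Data.List.Membership.Propositional using (_∈_)
open import Data.List.Properties using (upTo-∷ʳ; concatMap-++)
open import Data.List.Relation.Unary.All as All using (All; []; _∷_; all?)
open import Data.List.Relation.Unary.All.Properties using (++⁺; concat⁺; map⁺; applyUpTo⁺₁; applyUpTo⁻; all⁺)
open import Data.List.Relation.Unary.Any using (Any; here; there)
open import Data.List.Relation.Unary.Any.Properties using (any⁻)
open import Data.Nat
open import Data.Nat.DivMod using (_/_; _%_; m*n/n≡m; m≡m%n+[m/n]*n; m%n<n)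
open import Data.Nat.Divisibility using (_∣_; divides; ∣m+n∣m⇒∣n; n∣m*n; n∣m⇒m%n≡0; m%n≡0⇒n∣m)
open import Data.Nat.Properties
open import Data.Nat.Solver using (module +-*-Solver)
open import Data.Product using (_×_; _,_; proj₁; proj₂; ∃-syntax)
open import Data.Product.Properties using (≡-dec)
open import Data.List.Membership.DecPropositional (≡-dec _≟_ (≡-dec _≟_ _≟_)) using (_∈?_)
open import Data.Sum as Sum using (_⊎_; inj₁; inj₂)
open import Data.Vec as Vec using (Vec; []; _∷_; lookup)
open import Function using (id)
open import Function.Bundles using (Equivalence)
open import Relation.Binary.PropositionalEquality using (_≡_; refl; sym; trans; cong; cong₂; subst; module ≡-Reasoning)
open import Relation.Nullary using (Dec; yes; no; ¬_)
open import Relation.Nullary.Decidable using (from-yes; _×-dec_)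

open +-*-Solver using (solve; _:+_; _:*_; _:=_; con)

-- Counting multisets of monomials

⟦_≤_⟧ : ℕ → ℕ → ℕ
⟦ zero  ≤ n     ⟧ = 1
⟦ suc m ≤ zero  ⟧ = 0
⟦ suc m ≤ suc n ⟧ = ⟦ m ≤ n ⟧

⟦≤⟧-yes : ∀ {m n} → m ≤ n → ⟦ m ≤ n ⟧ ≡ 1
⟦≤⟧-yes z≤n       = refl
⟦≤⟧-yes (s≤s m≤n) = ⟦≤⟧-yes m≤n

⟦≤⟧-no : ∀ {m n} → n < m → ⟦ m ≤ n ⟧ ≡ 0
⟦≤⟧-no {suc m} {zero}  _         = refl
⟦≤⟧-no {suc m} {suc n} (s≤s n<m) = ⟦≤⟧-no n<m

⟦+≤⟧ : ∀ x y z → ⟦ x + y ≤ z ⟧ ≡ ⟦ x ≤ z ⟧ * ⟦ y ≤ z ∸ x ⟧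
⟦+≤⟧ zero    y z       = sym (+-identityʳ _)
⟦+≤⟧ (suc x) y zero    = refl
⟦+≤⟧ (suc x) y (suc z) = ⟦+≤⟧ x y z

⟦+≤+⟧ : ∀ x y z → ⟦ x + y ≤ x + z ⟧ ≡ ⟦ y ≤ z ⟧
⟦+≤+⟧ zero    y z = refl
⟦+≤+⟧ (suc x) y z = ⟦+≤+⟧ x y z

≤ᵀ?-⟦≤⟧ : ∀ a b c a′ b′ c′ →
          (a , b , c) ≤ᵀ? (a′ , b′ , c′) ≡ ⟦ a ≤ a′ ⟧ * ⟦ b ≤ b′ ⟧ * ⟦ c ≤ c′ ⟧
≤ᵀ?-⟦≤⟧ a b c a′ b′ c′ with a ≤? a′ | b ≤? b′ | c ≤? c′
... | yes p | yes q | yes r rewrite ⟦≤⟧-yes p | ⟦≤⟧-yes q | ⟦≤⟧-yes r = refl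
... | no ¬p | _     | _     rewrite ⟦≤⟧-no (≰⇒> ¬p) = refl
... | yes _ | no ¬q | _     rewrite ⟦≤⟧-no (≰⇒> ¬q) | *-zeroʳ ⟦ a ≤ a′ ⟧ = refl
... | yes _ | yes _ | no ¬r rewrite ⟦≤⟧-no (≰⇒> ¬r) = sym (*-zeroʳ (⟦ a ≤ a′ ⟧ * ⟦ b ≤ b′ ⟧))

≤ᵀ?-⊕ : ∀ u v w → ((u ⊕ v) ≤ᵀ? w) ≡ (u ≤ᵀ? w) * (v ≤ᵀ? (w ∸ᵀ u))
≤ᵀ?-⊕ (a , b , c) (a′ , b′ , c′) (x , y , z)
  rewrite ≤ᵀ?-⟦≤⟧ (a + a′) (b + b′) (c + c′) x y z | ≤ᵀ?-⟦≤⟧ a b c x y z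
        | ≤ᵀ?-⟦≤⟧ a′ b′ c′ (x ∸ a) (y ∸ b) (z ∸ c)
        | ⟦+≤⟧ a a′ x | ⟦+≤⟧ b b′ y | ⟦+≤⟧ c c′ z
  = interchange ⟦ a ≤ x ⟧ ⟦ a′ ≤ x ∸ a ⟧ ⟦ b ≤ y ⟧ ⟦ b′ ≤ y ∸ b ⟧ ⟦ c ≤ z ⟧ ⟦ c′ ≤ z ∸ c ⟧
  where
  interchange : ∀ p p′ q q′ r r′ → p * p′ * (q * q′) * (r * r′) ≡ p * q * r * (p′ * q′ * r′)
  interchange = solve 6 (λ p p′ q q′ r r′ →
    p :* p′ :* (q :* q′) :* (r :* r′) := p :* q :* r :* (p′ :* q′ :* r′)) refl

∸ᵀ-⊕ : ∀ w u v → w ∸ᵀ (u ⊕ v) ≡ (w ∸ᵀ u) ∸ᵀ v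
∸ᵀ-⊕ (x , y , z) (a , b , c) (a′ , b′ , c′) =
  sym (cong₂ _,_ (∸-+-assoc x a a′) (cong₂ _,_ (∸-+-assoc y b b′) (∸-+-assoc z c c′)))

-- The recursion "use the first monomial once more, or never again".
multisetCount′ : List Triple → ℕ → Triple → ℕ
multisetCount′ []       zero    w = isZeroᵀ w
multisetCount′ []       (suc d) w = 0
multisetCount′ (m ∷ ms) zero    w = multisetCount′ ms zero w
multisetCount′ (m ∷ ms) (suc d) w =
  multisetCount′ ms (suc d) w + (m ≤ᵀ? w) * multisetCount′ (m ∷ ms) d (w ∸ᵀ m)

summand : Triple → List Triple → Triple → ℕ → ℕ → ℕ
summand m ms w d j = ((suc j • m) ≤ᵀ? w) * multisetCount ms (d ∸ suc j) (w ∸ᵀ (suc j • m))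

-- partialSum m ms w d is the local loop `go` of multisetCount (m ∷ ms) d w. A where-bound
-- function cannot be named, so partialSum is a metavariable, solved by unification in unfold.
module _ (m : Triple) (ms : List Triple) (w : Triple) where
  mutual
    partialSum : ℕ → ℕ → ℕ
    partialSum = _

    private
      unfold : ∀ d → multisetCount (m ∷ ms) (suc d) w ≡ partialSum (suc d) d + summand m ms w (suc d) d
      unfold d with suc d
      ... | _ = refl

summand-suc : ∀ m ms w d j → summand m ms w (suc d) (suc j) ≡ (m ≤ᵀ? w) * summand m ms (w ∸ᵀ m) d j
summand-suc m ms w d j = begin
  ((m ⊕ k • m) ≤ᵀ? w) * multisetCount ms (d ∸ k) (w ∸ᵀ (m ⊕ k • m))
    ≡⟨ cong₂ _*_ (≤ᵀ?-⊕ m (k • m) w) (cong (multisetCount ms (d ∸ k)) (∸ᵀ-⊕ w m (k • m))) ⟩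
  (m ≤ᵀ? w) * ((k • m) ≤ᵀ? (w ∸ᵀ m)) * multisetCount ms (d ∸ k) ((w ∸ᵀ m) ∸ᵀ (k • m))
    ≡⟨ *-assoc (m ≤ᵀ? w) _ _ ⟩
  (m ≤ᵀ? w) * summand m ms (w ∸ᵀ m) d j ∎
  where
  open ≡-Reasoning
  k = suc j

partialSum-suc : ∀ m ms w d j →
  partialSum m ms w (suc d) (suc j) ≡ multisetCount ms (suc d) w + (m ≤ᵀ? w) * partialSum m ms (w ∸ᵀ m) d j
partialSum-suc m ms w d zero =
  cong (λ m′ → multisetCount ms (suc d) w + (m′ ≤ᵀ? w) * multisetCount ms d (w ∸ᵀ m′)) (1•m≡m m)
  where
  1•m≡m : ∀ m → 1 • m ≡ m
  1•m≡m (a , b , c) = cong₂ _,_ (+-identityʳ a) (cong₂ _,_ (+-identityʳ b) (+-identityʳ c))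
partialSum-suc m ms w d (suc j) = begin
  partialSum m ms w (suc d) (suc j) + summand m ms w (suc d) (suc j)
    ≡⟨ cong₂ _+_ (partialSum-suc m ms w d j) (summand-suc m ms w d j) ⟩
  (multisetCount ms (suc d) w + χ * partialSum m ms (w ∸ᵀ m) d j) + χ * summand m ms (w ∸ᵀ m) d j
    ≡⟨ +-assoc (multisetCount ms (suc d) w) _ _ ⟩
  multisetCount ms (suc d) w + (χ * partialSum m ms (w ∸ᵀ m) d j + χ * summand m ms (w ∸ᵀ m) d j)
    ≡⟨ cong (λ s → multisetCount ms (suc d) w + s) (*-distribˡ-+ χ _ _) ⟨
  multisetCount ms (suc d) w + χ * partialSum m ms (w ∸ᵀ m) d (suc j) ∎
  where
  open ≡-Reasoning
  χ = m ≤ᵀ? w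

multisetCount≡multisetCount′ : ∀ ms d w → multisetCount ms d w ≡ multisetCount′ ms d w
multisetCount≡multisetCount′ []       zero    w = refl
multisetCount≡multisetCount′ []       (suc d) w = refl
multisetCount≡multisetCount′ (m ∷ ms) zero    w = multisetCount≡multisetCount′ ms zero w
multisetCount≡multisetCount′ (m ∷ ms) (suc d) w = trans (partialSum-suc m ms w d d)
  (cong₂ (λ x y → x + (m ≤ᵀ? w) * y) (multisetCount≡multisetCount′ ms (suc d) w)
                                      (multisetCount≡multisetCount′ (m ∷ ms) d (w ∸ᵀ m)))

monomialsWithFirst : ℕ → ℕ → List Triple
monomialsWithFirst n a = map (λ b → (a , b , n ∸ a ∸ b)) (upTo (suc (n ∸ a)))

monomialsBelow : ℕ → List Triple
monomialsBelow n = concatMap (monomialsWithFirst n) (upTo n)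

monomials-size : ∀ n → All (λ m → size m ≡ n) (monomials n)
monomials-size n = concat⁺ (map⁺ {f = monomialsWithFirst n} (applyUpTo⁺₁ id (suc n) λ a<1+n →
  map⁺ (applyUpTo⁺₁ id _ λ b<1+n∸a → size≡ (≤-pred a<1+n) (≤-pred b<1+n∸a))))
  where
  size≡ : ∀ {a b} → a ≤ n → b ≤ n ∸ a → a + b + (n ∸ a ∸ b) ≡ n
  size≡ {a} {b} a≤n b≤n∸a = begin
    a + b + (n ∸ a ∸ b)   ≡⟨ +-assoc a b _ ⟩
    a + (b + (n ∸ a ∸ b)) ≡⟨ cong (λ s → a + s) (m+[n∸m]≡n b≤n∸a) ⟩
    a + (n ∸ a)           ≡⟨ m+[n∸m]≡n a≤n ⟩
    n                     ∎
    where open ≡-Reasoning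

monomials-split : ∀ n → monomials n ≡ monomialsBelow n ++ (n , 0 , 0) ∷ []
monomials-split n = begin
  concatMap (monomialsWithFirst n) (upTo (suc n))
    ≡⟨ cong (concatMap (monomialsWithFirst n)) (upTo-∷ʳ n) ⟨
  concatMap (monomialsWithFirst n) (upTo n ++ n ∷ [])
    ≡⟨ concatMap-++ (monomialsWithFirst n) (upTo n) (n ∷ []) ⟩
  monomialsBelow n ++ monomialsWithFirst n n ++ []
    ≡⟨ cong (λ k → monomialsBelow n ++ map (λ b → (n , b , k ∸ b)) (upTo (suc k)) ++ []) (n∸n≡0 n) ⟩
  monomialsBelow n ++ (n , 0 , 0) ∷ [] ∎
  where open ≡-Reasoning

monomialsBelow-< : ∀ n → All (λ m → proj₁ m < n) (monomialsBelow n)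
monomialsBelow-< n = concat⁺ (map⁺ {f = monomialsWithFirst n} (applyUpTo⁺₁ id n λ a<n →
  map⁺ (All.universal (λ _ → a<n) _)))

-- Stability

multisetCount′-zero : ∀ L {a} b c → 0 < a → multisetCount′ L 0 (a , b , c) ≡ 0
multisetCount′-zero []       b c (s≤s _) = refl
multisetCount′-zero (m ∷ ms) b c 0<a     = multisetCount′-zero ms b c 0<a

stability-arith : ∀ {n m₁ x d} → m₁ < n → n * suc d ≤ x + suc d → m₁ ≤ x × n * d ≤ (x ∸ m₁) + d
stability-arith {n} {m₁} {x} {d} m₁<n ineq = m₁≤x , +-cancelˡ-≤ m₁ _ _ (begin
    m₁ + n * d          ≤⟨ m₁+nd≤x+d ⟩
    x + d               ≡⟨ cong (_+ d) (m+[n∸m]≡n m₁≤x) ⟨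
    m₁ + (x ∸ m₁) + d   ≡⟨ +-assoc m₁ _ d ⟩
    m₁ + (x ∸ m₁ + d)   ∎)
  where
  open ≤-Reasoning
  m₁+nd≤x+d : m₁ + n * d ≤ x + d
  m₁+nd≤x+d = ≤-pred (begin
    suc m₁ + n * d ≤⟨ +-monoˡ-≤ (n * d) m₁<n ⟩
    n + n * d      ≡⟨ *-suc n d ⟨
    n * suc d      ≤⟨ ineq ⟩
    x + suc d      ≡⟨ +-suc x d ⟩
    suc (x + d)    ∎)
  m₁≤x : m₁ ≤ x
  m₁≤x = +-cancelʳ-≤ d m₁ x
    (≤-trans (+-monoʳ-≤ m₁ (m≤n*m d n {{>-nonZero (≤-trans (s≤s z≤n) m₁<n)}})) m₁+nd≤x+d)

module _ (n : ℕ) where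
  private
    xⁿ : Triple
    xⁿ = (n , 0 , 0)

  multisetCount′-stable : ∀ ms → All (λ m → proj₁ m < n) ms → ∀ d x y z → n * d ≤ x + d →
    multisetCount′ (ms ++ xⁿ ∷ []) (suc d) (n + x , y , z) ≡ multisetCount′ (ms ++ xⁿ ∷ []) d (x , y , z)
  multisetCount′-stable [] [] d x y z _
    rewrite ≤ᵀ?-⟦≤⟧ n 0 0 (n + x) y z | ⟦≤⟧-yes (m≤m+n n x) | m+n∸m≡n n x
    = +-identityʳ (multisetCount′ (xⁿ ∷ []) d (x , y , z))
  multisetCount′-stable ((m₁ , m₂ , m₃) ∷ ms) (m₁<n ∷ below) zero x y z _ = begin
    multisetCount′ (ms ++ xⁿ ∷ []) 1 (n + x , y , z) + χ * multisetCount′ L 0 (n + x ∸ m₁ , y ∸ m₂ , z ∸ m₃)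
      ≡⟨ cong₂ (λ u v → u + χ * v)
               (multisetCount′-stable ms below 0 x y z (subst (_≤ x + 0) (sym (*-zeroʳ n)) z≤n))
               (multisetCount′-zero L _ _ (m<n⇒0<n∸m (≤-trans m₁<n (m≤m+n n x)))) ⟩
    multisetCount′ (ms ++ xⁿ ∷ []) 0 (x , y , z) + χ * 0
      ≡⟨ cong (λ v → multisetCount′ (ms ++ xⁿ ∷ []) 0 (x , y , z) + v) (*-zeroʳ χ) ⟩
    multisetCount′ (ms ++ xⁿ ∷ []) 0 (x , y , z) + 0
      ≡⟨ +-identityʳ _ ⟩
    multisetCount′ L 0 (x , y , z) ∎
    where
    open ≡-Reasoning
    L = (m₁ , m₂ , m₃) ∷ ms ++ xⁿ ∷ []
    χ = (m₁ , m₂ , m₃) ≤ᵀ? (n + x , y , z)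
  multisetCount′-stable ((m₁ , m₂ , m₃) ∷ ms) (m₁<n ∷ below) (suc d) x y z ineq =
    cong₂ _+_ (multisetCount′-stable ms below (suc d) x y z ineq) (cong₂ _*_ same-χ (begin
      multisetCount′ L (suc d) (n + x ∸ m₁ , y ∸ m₂ , z ∸ m₃)
        ≡⟨ cong (λ u → multisetCount′ L (suc d) (u , y ∸ m₂ , z ∸ m₃)) (+-∸-assoc n m₁≤x) ⟩
      multisetCount′ L (suc d) (n + (x ∸ m₁) , y ∸ m₂ , z ∸ m₃)
        ≡⟨ multisetCount′-stable (_ ∷ ms) (m₁<n ∷ below) d (x ∸ m₁) (y ∸ m₂) (z ∸ m₃) ineq′ ⟩
      multisetCount′ L d (x ∸ m₁ , y ∸ m₂ , z ∸ m₃) ∎))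
    where
    open ≡-Reasoning
    L = (m₁ , m₂ , m₃) ∷ ms ++ xⁿ ∷ []
    m₁≤x = proj₁ (stability-arith m₁<n ineq)
    ineq′ = proj₂ (stability-arith m₁<n ineq)
    same-χ : ((m₁ , m₂ , m₃) ≤ᵀ? (n + x , y , z)) ≡ ((m₁ , m₂ , m₃) ≤ᵀ? (x , y , z))
    same-χ rewrite ≤ᵀ?-⟦≤⟧ m₁ m₂ m₃ (n + x) y z | ≤ᵀ?-⟦≤⟧ m₁ m₂ m₃ x y z
                 | ⟦≤⟧-yes m₁≤x | ⟦≤⟧-yes (≤-trans m₁≤x (m≤n+m x n)) = refl

plethWeight≡multisetCount′ : ∀ n d w →
  plethWeight d n w ≡ multisetCount′ (monomialsBelow n ++ (n , 0 , 0) ∷ []) d w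
plethWeight≡multisetCount′ n d w = trans (multisetCount≡multisetCount′ (monomials n) d w)
                                         (cong (λ L → multisetCount′ L d w) (monomials-split n))

plethWeight-stable : ∀ n d x y z → n * d ≤ x + d →
                     plethWeight (suc d) n (n + x , y , z) ≡ plethWeight d n (x , y , z)
plethWeight-stable n d x y z ineq = begin
  plethWeight (suc d) n (n + x , y , z)
    ≡⟨ plethWeight≡multisetCount′ n (suc d) _ ⟩
  multisetCount′ (monomialsBelow n ++ (n , 0 , 0) ∷ []) (suc d) (n + x , y , z)
    ≡⟨ multisetCount′-stable n _ (monomialsBelow-< n) d x y z ineq ⟩
  multisetCount′ (monomialsBelow n ++ (n , 0 , 0) ∷ []) d (x , y , z)
    ≡⟨ plethWeight≡multisetCount′ n d _ ⟨
  plethWeight d n (x , y , z) ∎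
  where open ≡-Reasoning

-- plethysmCoeff d n is bialternant (plethWeightℤ d n) by definition.
bialternant : (ℤ → ℤ → ℤ → ℤ) → Triple → ℤ
bialternant P (a , b , c) =
  let A = + a ; B = + b ; C = + c
  in   P A B C
     ℤ.- P (A ℤ.+ + 1) (B ℤ.- + 1) C
     ℤ.- P A (B ℤ.+ + 1) (C ℤ.- + 1)
     ℤ.- P (A ℤ.+ + 2) B (C ℤ.- + 2)
     ℤ.+ P (A ℤ.+ + 1) (B ℤ.+ + 1) (C ℤ.- + 2)
     ℤ.+ P (A ℤ.+ + 2) (B ℤ.- + 1) (C ℤ.- + 1)

bialternant-shift : ∀ P Q k a b c → (∀ {x} Y Z → a ≤ x → P (+ (k + x)) Y Z ≡ Q (+ x) Y Z) →
                    bialternant P (k + a , b , c) ≡ bialternant Q (a , b , c)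
bialternant-shift P Q k a b c eq =
  cong₂ ℤ._+_ (cong₂ ℤ._+_ (cong₂ ℤ._-_ (cong₂ ℤ._-_ (cong₂ ℤ._-_
    (eq _ _ ≤-refl) (at 1)) (eq _ _ ≤-refl)) (at 2)) (at 1)) (at 2)
  where
  at : ∀ i {Y Z} → P (+ (k + a + i)) Y Z ≡ Q (+ (a + i)) Y Z
  at i {Y} {Z} = trans (cong (λ x → P (+ x) Y Z) (+-assoc k a i)) (eq Y Z (m≤m+n a i))

plethWeightℤ-stable : ∀ n d x Y Z → n * d ≤ x + d →
                      plethWeightℤ (suc d) n (+ (n + x)) Y Z ≡ plethWeightℤ d n (+ x) Y Z
plethWeightℤ-stable n d x (+ y)    (+ z)    ineq = cong +_ (plethWeight-stable n d x y z ineq)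
plethWeightℤ-stable n d x (+ y)    -[1+ z ] ineq = refl
plethWeightℤ-stable n d x -[1+ y ] Z        ineq = refl

plethysmCoeff-stable : ∀ n d a b c → n * d ≤ a + d →
                       plethysmCoeff (suc d) n (n + a , b , c) ≡ plethysmCoeff d n (a , b , c)
plethysmCoeff-stable n d a b c ineq =
  bialternant-shift (plethWeightℤ (suc d) n) (plethWeightℤ d n) n a b c λ {x} Y Z a≤x →
    plethWeightℤ-stable n d x Y Z (≤-trans ineq (+-monoˡ-≤ d a≤x))

plethysmCoeff-stable* : ∀ n i d a b c → n * d ≤ a + d →
                        plethysmCoeff (i + d) n (i * n + a , b , c) ≡ plethysmCoeff d n (a , b , c)
plethysmCoeff-stable* n zero    d a b c ineq = refl
plethysmCoeff-stable* n (suc i) d a b c ineq =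
  trans (cong (λ x → plethysmCoeff (suc i + d) n (x , b , c)) (+-assoc n (i * n) a))
        (trans (plethysmCoeff-stable n (i + d) (i * n + a) b c ineq′) (plethysmCoeff-stable* n i d a b c ineq))
  where
  open ≤-Reasoning
  ineq′ : n * (i + d) ≤ i * n + a + (i + d)
  ineq′ = begin
    n * (i + d)           ≡⟨ *-distribˡ-+ n i d ⟩
    n * i + n * d         ≤⟨ +-mono-≤ (≤-reflexive (*-comm n i)) ineq ⟩
    i * n + (a + d)       ≡⟨ +-assoc (i * n) a d ⟨
    i * n + a + d         ≤⟨ +-monoʳ-≤ (i * n + a) (m≤n+m d i) ⟩
    i * n + a + (i + d)   ∎

-- Tabulating weight multiplicities

⟦≤⟧-peel : ∀ (h : ℕ → ℕ) s x N →
           ⟦ s ≤ x + N ⟧ * (⟦ x ≤ x + N ∸ s ⟧ * h (x + N ∸ s ∸ x)) ≡ ⟦ s ≤ N ⟧ * h (N ∸ s)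
⟦≤⟧-peel h s x N = begin
  ⟦ s ≤ x + N ⟧ * (⟦ x ≤ x + N ∸ s ⟧ * h (x + N ∸ s ∸ x))
    ≡⟨ *-assoc ⟦ s ≤ x + N ⟧ _ _ ⟨
  ⟦ s ≤ x + N ⟧ * ⟦ x ≤ x + N ∸ s ⟧ * h (x + N ∸ s ∸ x)
    ≡⟨ cong₂ _*_ (⟦+≤⟧ s x (x + N)) (cong h (sym (∸-+-assoc (x + N) s x))) ⟨
  ⟦ s + x ≤ x + N ⟧ * h (x + N ∸ (s + x))
    ≡⟨ cong (λ u → ⟦ u ≤ x + N ⟧ * h (x + N ∸ u)) (+-comm s x) ⟩
  ⟦ x + s ≤ x + N ⟧ * h (x + N ∸ (x + s))
    ≡⟨ cong₂ _*_ (⟦+≤+⟧ x s N) (cong h ([m+n]∸[m+o]≡n∸o x N s)) ⟩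
  ⟦ s ≤ N ⟧ * h (N ∸ s) ∎
  where open ≡-Reasoning

module _ (n : ℕ) where

  -- For monomials of degree n the third coordinate of a weight of degree d is n d - a - b.
  planarCount : List Triple → ℕ → ℕ → ℕ → ℕ
  planarCount L d a b = ⟦ a + b ≤ n * d ⟧ * multisetCount′ L d (a , b , n * d ∸ (a + b))

  planarCount≡multisetCount′ : ∀ L d a b c → a + b + c ≡ n * d →
                               planarCount L d a b ≡ multisetCount′ L d (a , b , c)
  planarCount≡multisetCount′ L d a b c size≡ = begin
    ⟦ a + b ≤ n * d ⟧ * multisetCount′ L d (a , b , n * d ∸ (a + b))
      ≡⟨ cong₂ (λ u v → u * multisetCount′ L d (a , b , v)) (⟦≤⟧-yes a+b≤) c≡ ⟩
    1 * multisetCount′ L d (a , b , c)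
      ≡⟨ *-identityˡ _ ⟩
    multisetCount′ L d (a , b , c) ∎
    where
    open ≡-Reasoning
    a+b≤ : a + b ≤ n * d
    a+b≤ = subst (a + b ≤_) size≡ (m≤m+n (a + b) c)
    c≡ : n * d ∸ (a + b) ≡ c
    c≡ = trans (cong (_∸ (a + b)) (sym size≡)) (m+n∸m≡n (a + b) c)

  planarCount-[]-suc : ∀ d a b → planarCount [] (suc d) a b ≡ 0
  planarCount-[]-suc d a b = *-zeroʳ ⟦ a + b ≤ n * suc d ⟧

  private
    peel-monomial : ∀ m₁ m₂ m₃ ms d a b → m₁ + m₂ + m₃ ≡ n →
      let L = (m₁ , m₂ , m₃) ∷ ms ; c = n * suc d ∸ (m₁ + a + (m₂ + b)) in
      ⟦ m₁ + a + (m₂ + b) ≤ n * suc d ⟧ * (⟦ m₃ ≤ c ⟧ * multisetCount′ L d (a , b , c ∸ m₃))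
        ≡ planarCount L d a b
    peel-monomial m₁ m₂ m₃ ms d a b size≡ = begin
      ⟦ S ≤ N′ ⟧ * (⟦ m₃ ≤ N′ ∸ S ⟧ * h (N′ ∸ S ∸ m₃))
        ≡⟨ cong₂ (λ u v → ⟦ u ≤ v ⟧ * (⟦ m₃ ≤ v ∸ u ⟧ * h (v ∸ u ∸ m₃))) S≡ N′≡ ⟩
      ⟦ M + s ≤ M + (m₃ + N) ⟧ * (⟦ m₃ ≤ M + (m₃ + N) ∸ (M + s) ⟧ * h (M + (m₃ + N) ∸ (M + s) ∸ m₃))
        ≡⟨ cong₂ (λ u v → u * (⟦ m₃ ≤ v ⟧ * h (v ∸ m₃)))
                 (⟦+≤+⟧ M s (m₃ + N)) ([m+n]∸[m+o]≡n∸o M (m₃ + N) s) ⟩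
      ⟦ s ≤ m₃ + N ⟧ * (⟦ m₃ ≤ m₃ + N ∸ s ⟧ * h (m₃ + N ∸ s ∸ m₃))
        ≡⟨ ⟦≤⟧-peel h s m₃ N ⟩
      ⟦ s ≤ N ⟧ * h (N ∸ s) ∎
      where
      open ≡-Reasoning
      h = λ z → multisetCount′ ((m₁ , m₂ , m₃) ∷ ms) d (a , b , z)
      S = m₁ + a + (m₂ + b)
      M = m₁ + m₂
      s = a + b
      N = n * d
      N′ = n * suc d
      S≡ : S ≡ M + s
      S≡ = solve 4 (λ m₁ m₂ a b → m₁ :+ a :+ (m₂ :+ b) := m₁ :+ m₂ :+ (a :+ b)) refl m₁ m₂ a b
      N′≡ : N′ ≡ M + (m₃ + N)
      N′≡ = trans (*-suc n d) (trans (cong (_+ N) (sym size≡)) (+-assoc M m₃ N))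

  planarCount-∷-suc : ∀ m₁ m₂ m₃ ms d a b → m₁ + m₂ + m₃ ≡ n →
    planarCount ((m₁ , m₂ , m₃) ∷ ms) (suc d) a b
      ≡ planarCount ms (suc d) a b
        + ⟦ m₁ ≤ a ⟧ * ⟦ m₂ ≤ b ⟧ * planarCount ((m₁ , m₂ , m₃) ∷ ms) d (a ∸ m₁) (b ∸ m₂)
  planarCount-∷-suc m₁ m₂ m₃ ms d a b size≡ =
    trans (*-distribˡ-+ ⟦ a + b ≤ n * suc d ⟧ _ _)
          (cong (λ t → planarCount ms (suc d) a b + t) (new-term (m₁ ≤? a) (m₂ ≤? b)))
    where
    L = (m₁ , m₂ , m₃) ∷ ms
    c = n * suc d ∸ (a + b)
    new-term : Dec (m₁ ≤ a) → Dec (m₂ ≤ b) →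
      ⟦ a + b ≤ n * suc d ⟧ * (((m₁ , m₂ , m₃) ≤ᵀ? (a , b , c))
                                * multisetCount′ L d ((a , b , c) ∸ᵀ (m₁ , m₂ , m₃)))
        ≡ ⟦ m₁ ≤ a ⟧ * ⟦ m₂ ≤ b ⟧ * planarCount L d (a ∸ m₁) (b ∸ m₂)
    new-term (no m₁≰a) _
      rewrite ≤ᵀ?-⟦≤⟧ m₁ m₂ m₃ a b c | ⟦≤⟧-no (≰⇒> m₁≰a)
      = *-zeroʳ ⟦ a + b ≤ n * suc d ⟧
    new-term (yes _) (no m₂≰b)
      rewrite ≤ᵀ?-⟦≤⟧ m₁ m₂ m₃ a b c | ⟦≤⟧-no (≰⇒> m₂≰b) | *-zeroʳ ⟦ m₁ ≤ a ⟧
      = *-zeroʳ ⟦ a + b ≤ n * suc d ⟧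
    new-term (yes m₁≤a) (yes m₂≤b) with m≤n⇒∃[o]m+o≡n m₁≤a | m≤n⇒∃[o]m+o≡n m₂≤b
    ... | a′ , refl | b′ , refl
      rewrite ≤ᵀ?-⟦≤⟧ m₁ m₂ m₃ (m₁ + a′) (m₂ + b′) c
            | ⟦≤⟧-yes (m≤m+n m₁ a′) | ⟦≤⟧-yes (m≤m+n m₂ b′) | m+n∸m≡n m₁ a′ | m+n∸m≡n m₂ b′
      = trans (cong (λ u → ⟦ m₁ + a′ + (m₂ + b′) ≤ n * suc d ⟧ * (u * multisetCount′ L d (a′ , b′ , c ∸ m₃)))
                    (+-identityʳ ⟦ m₃ ≤ c ⟧))
              (trans (peel-monomial m₁ m₂ m₃ ms d a′ b′ size≡) (sym (+-identityʳ _)))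

Row : Set
Row = List ℕ

Grid : Set
Grid = List Row

at : Row → ℕ → ℕ
at []       _       = 0
at (x ∷ xs) zero    = x
at (x ∷ xs) (suc i) = at xs i

entry : Grid → ℕ → ℕ → ℕ
entry []      _       _ = 0
entry (r ∷ g) zero    b = at r b
entry (r ∷ g) (suc a) b = entry g a b

infixl 6 _⊞ʳ_ _⊞_

_⊞ʳ_ : Row → Row → Row
[]       ⊞ʳ ys       = ys
(x ∷ xs) ⊞ʳ []       = x ∷ xs
(x ∷ xs) ⊞ʳ (y ∷ ys) = x + y ∷ xs ⊞ʳ ys

_⊞_ : Grid → Grid → Grid
[]      ⊞ h       = h
(r ∷ g) ⊞ []      = r ∷ g
(r ∷ g) ⊞ (s ∷ h) = r ⊞ʳ s ∷ g ⊞ h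

shift : ℕ → ℕ → Grid → Grid
shift m₁ m₂ g = replicate m₁ [] ++ map (replicate m₂ 0 ++_) g

crop : ℕ → ℕ → Grid → Grid
crop A B g = map (take B) (take A g)

at-⊞ʳ : ∀ xs ys i → at (xs ⊞ʳ ys) i ≡ at xs i + at ys i
at-⊞ʳ []       ys       i       = refl
at-⊞ʳ (x ∷ xs) []       i       = sym (+-identityʳ _)
at-⊞ʳ (x ∷ xs) (y ∷ ys) zero    = refl
at-⊞ʳ (x ∷ xs) (y ∷ ys) (suc i) = at-⊞ʳ xs ys i

entry-⊞ : ∀ g h a b → entry (g ⊞ h) a b ≡ entry g a b + entry h a b
entry-⊞ []      h       a       b = refl
entry-⊞ (r ∷ g) []      a       b = sym (+-identityʳ _)
entry-⊞ (r ∷ g) (s ∷ h) zero    b = at-⊞ʳ r s b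
entry-⊞ (r ∷ g) (s ∷ h) (suc a) b = entry-⊞ g h a b

at-padded : ∀ k xs i → at (replicate k 0 ++ xs) i ≡ ⟦ k ≤ i ⟧ * at xs (i ∸ k)
at-padded zero    xs i       = sym (+-identityʳ _)
at-padded (suc k) xs zero    = refl
at-padded (suc k) xs (suc i) = at-padded k xs i

entry-padded-rows : ∀ k g a b → entry (replicate k [] ++ g) a b ≡ ⟦ k ≤ a ⟧ * entry g (a ∸ k) b
entry-padded-rows zero    g a       b = sym (+-identityʳ _)
entry-padded-rows (suc k) g zero    b = refl
entry-padded-rows (suc k) g (suc a) b = entry-padded-rows k g a b

entry-padded-columns : ∀ k g a b →
                       entry (map (replicate k 0 ++_) g) a b ≡ ⟦ k ≤ b ⟧ * entry g a (b ∸ k)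
entry-padded-columns k []      a       b = sym (*-zeroʳ ⟦ k ≤ b ⟧)
entry-padded-columns k (r ∷ g) zero    b = at-padded k r b
entry-padded-columns k (r ∷ g) (suc a) b = entry-padded-columns k g a b

entry-shift : ∀ m₁ m₂ g a b →
              entry (shift m₁ m₂ g) a b ≡ ⟦ m₁ ≤ a ⟧ * ⟦ m₂ ≤ b ⟧ * entry g (a ∸ m₁) (b ∸ m₂)
entry-shift m₁ m₂ g a b = trans (entry-padded-rows m₁ _ a b)
  (trans (cong (⟦ m₁ ≤ a ⟧ *_) (entry-padded-columns m₂ g (a ∸ m₁) b)) (sym (*-assoc ⟦ m₁ ≤ a ⟧ _ _)))

at-take : ∀ B xs {i} → i < B → at (take B xs) i ≡ at xs i
at-take (suc B) []       _                 = refl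
at-take (suc B) (x ∷ xs) {zero}  _         = refl
at-take (suc B) (x ∷ xs) {suc i} (s≤s i<B) = at-take B xs i<B

entry-crop : ∀ A B g {a b} → a < A → b < B → entry (crop A B g) a b ≡ entry g a b
entry-crop (suc A) B []      _                 _   = refl
entry-crop (suc A) B (r ∷ g) {zero}  _         b<B = at-take B r b<B
entry-crop (suc A) B (r ∷ g) {suc a} (s≤s a<A) b<B = entry-crop A B g a<A b<B

scanl : ∀ {A B : Set} {k} → (A → B → A) → A → Vec B k → Vec A (suc k)
scanl f e []       = e ∷ []
scanl f e (x ∷ xs) = e ∷ scanl f (f e x) xs

-- Row d of layers D L, cropped to the window A × B, holds the weight multiplicities of degree d
-- multisets from L; adding a monomial m to L is the knapsack update along the rows.
module Tabulation (n A B : ℕ) where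

  Tabulates : List Triple → ℕ → Grid → Set
  Tabulates L d g = ∀ {a b} → a < A → b < B → entry g a b ≡ planarCount n L d a b

  data Tabulating (L : List Triple) : ℕ → ∀ {k} → Vec Grid k → Set where
    []  : ∀ {d} → Tabulating L d []
    _∷_ : ∀ {d k g} {gs : Vec Grid k} →
          Tabulates L d g → Tabulating L (suc d) gs → Tabulating L d (g ∷ gs)

  step : Triple → Grid → Grid → Grid
  step (m₁ , m₂ , _) below g = crop A B (g ⊞ shift m₁ m₂ below)

  extend : ∀ {k} → Triple → Vec Grid (suc k) → Vec Grid (suc k)
  extend m (g ∷ gs) = scanl (step m) g gs

  layers : (D : ℕ) → List Triple → Vec Grid (suc D)
  layers D []       = ((1 ∷ []) ∷ []) ∷ Vec.replicate D []
  layers D (m ∷ ms) = extend m (layers D ms)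

  table : ℕ → List Triple → Grid
  table D L = lookup (layers D L) (fromℕ D)

  step-tabulates : ∀ {m₁ m₂ m₃ ms d below g} → m₁ + m₂ + m₃ ≡ n →
                   Tabulates ((m₁ , m₂ , m₃) ∷ ms) d below → Tabulates ms (suc d) g →
                   Tabulates ((m₁ , m₂ , m₃) ∷ ms) (suc d) (step (m₁ , m₂ , m₃) below g)
  step-tabulates {m₁} {m₂} {m₃} {ms} {d} {below} {g} size≡ below-tab g-tab {a} {b} a<A b<B = begin
    entry (crop A B (g ⊞ shift m₁ m₂ below)) a b
      ≡⟨ entry-crop A B _ a<A b<B ⟩
    entry (g ⊞ shift m₁ m₂ below) a b
      ≡⟨ entry-⊞ g _ a b ⟩
    entry g a b + entry (shift m₁ m₂ below) a b
      ≡⟨ cong₂ _+_ (g-tab a<A b<B) (entry-shift m₁ m₂ below a b) ⟩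
    planarCount n ms (suc d) a b + ⟦ m₁ ≤ a ⟧ * ⟦ m₂ ≤ b ⟧ * entry below (a ∸ m₁) (b ∸ m₂)
      ≡⟨ cong (λ v → planarCount n ms (suc d) a b + ⟦ m₁ ≤ a ⟧ * ⟦ m₂ ≤ b ⟧ * v)
              (below-tab (≤-<-trans (m∸n≤m a m₁) a<A) (≤-<-trans (m∸n≤m b m₂) b<B)) ⟩
    planarCount n ms (suc d) a b + ⟦ m₁ ≤ a ⟧ * ⟦ m₂ ≤ b ⟧ * planarCount n (_ ∷ ms) d (a ∸ m₁) (b ∸ m₂)
      ≡⟨ planarCount-∷-suc n m₁ m₂ m₃ ms d a b size≡ ⟨
    planarCount n ((m₁ , m₂ , m₃) ∷ ms) (suc d) a b ∎
    where open ≡-Reasoning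

  scanl-tabulating : ∀ {m ms d g k} {gs : Vec Grid k} → size m ≡ n → Tabulates (m ∷ ms) d g →
                     Tabulating ms (suc d) gs → Tabulating (m ∷ ms) d (scanl (step m) g gs)
  scanl-tabulating             size≡ g-tab []                = g-tab ∷ []
  scanl-tabulating {_ , _ , _} size≡ g-tab (g′-tab ∷ gs-tab) =
    g-tab ∷ scanl-tabulating size≡ (step-tabulates size≡ g-tab g′-tab) gs-tab

  unit-tabulates : Tabulates [] 0 ((1 ∷ []) ∷ [])
  unit-tabulates {a} {b} _ _ rewrite *-zeroʳ n = unit a b
    where
    unit : ∀ a b → entry ((1 ∷ []) ∷ []) a b ≡ ⟦ a + b ≤ 0 ⟧ * isZeroᵀ (a , b , 0 ∸ (a + b))
    unit zero    zero    = refl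
    unit zero    (suc b) = refl
    unit (suc a) b       = refl

  empty-tabulating : ∀ d k → Tabulating [] (suc d) (Vec.replicate k [])
  empty-tabulating d zero    = []
  empty-tabulating d (suc k) =
    (λ {a} {b} _ _ → sym (planarCount-[]-suc n d a b)) ∷ empty-tabulating (suc d) k

  layers-tabulating : ∀ D L → All (λ m → size m ≡ n) L → Tabulating L 0 (layers D L)
  layers-tabulating D []       []              = unit-tabulates ∷ empty-tabulating 0 D
  layers-tabulating D (m ∷ ms) (size≡ ∷ sizes) with layers D ms | layers-tabulating D ms sizes
  ... | g ∷ gs | g-tab ∷ gs-tab = scanl-tabulating size≡ g-tab gs-tab

  lookup-tabulates : ∀ {L d k} {gs : Vec Grid k} → Tabulating L d gs →
                     ∀ i → Tabulates L (toℕ i + d) (lookup gs i)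
  lookup-tabulates (g-tab ∷ _) Fin.zero = g-tab
  lookup-tabulates {L} {d} {gs = _ ∷ gs} (_ ∷ gs-tab) (Fin.suc i) =
    subst (λ e → Tabulates L e (lookup gs i)) (+-suc (toℕ i) d) (lookup-tabulates gs-tab i)

  table-tabulates : ∀ D L → All (λ m → size m ≡ n) L → Tabulates L D (table D L)
  table-tabulates D L sizes =
    subst (λ e → Tabulates L e (table D L)) (trans (+-identityʳ _) (toℕ-fromℕ D))
          (lookup-tabulates (layers-tabulating D L sizes) (fromℕ D))

zeroExtend : (ℕ → ℕ → ℕ → ℕ) → ℤ → ℤ → ℤ → ℤ
zeroExtend f (+ a) (+ b) (+ c) = + f a b c
zeroExtend f _     _     _     = + 0

module _ (n A B : ℕ) where
  open Tabulation n A B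

  -- Outside the window, or off the degree, fall back to the definition; the fallback is never
  -- evaluated in fastCoeff, but makes fastWeight-correct hold unconditionally.
  fastWeight : ℕ → Grid → ℕ → ℕ → ℕ → ℕ
  fastWeight d g a b c with a + b + c ≟ n * d | a <? A | b <? B
  ... | yes _ | yes _ | yes _ = entry g a b
  ... | _     | _     | _     = plethWeight d n (a , b , c)

  fastWeight-correct : ∀ d a b c → fastWeight d (table d (monomials n)) a b c ≡ plethWeight d n (a , b , c)
  fastWeight-correct d a b c with a + b + c ≟ n * d | a <? A | b <? B
  ... | yes size≡ | yes a<A | yes b<B = begin
    entry (table d (monomials n)) a b
      ≡⟨ table-tabulates d (monomials n) (monomials-size n) a<A b<B ⟩
    planarCount n (monomials n) d a b
      ≡⟨ planarCount≡multisetCount′ n (monomials n) d a b c size≡ ⟩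
    multisetCount′ (monomials n) d (a , b , c)
      ≡⟨ multisetCount≡multisetCount′ (monomials n) d (a , b , c) ⟨
    plethWeight d n (a , b , c) ∎
    where open ≡-Reasoning
  ... | yes _ | yes _ | no _ = refl
  ... | yes _ | no _  | _    = refl
  ... | no _  | _     | _    = refl

-- The six weights in the bialternant formula for (a , b , c) have first coordinate below a + 3
-- and second below b + 2.
fastCoeff : ℕ → ℕ → Triple → ℤ
fastCoeff n d (a , b , c) =
  bialternant (zeroExtend (fastWeight n (3 + a) (2 + b) d (table d (monomials n)))) (a , b , c)
  where open Tabulation n (3 + a) (2 + b)

fastCoeff≡plethysmCoeff : ∀ n d μ → fastCoeff n d μ ≡ plethysmCoeff d n μ
fastCoeff≡plethysmCoeff n d (a , b , c) = bialternant-shift P (plethWeightℤ d n) 0 a b c weight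
  where
  open Tabulation n (3 + a) (2 + b)
  P = zeroExtend (fastWeight n (3 + a) (2 + b) d (table d (monomials n)))
  weight : ∀ {x} Y Z → a ≤ x → P (+ x) Y Z ≡ plethWeightℤ d n (+ x) Y Z
  weight {x} (+ y)    (+ z)    _ = cong +_ (fastWeight-correct n (3 + a) (2 + b) d x y z)
  weight     (+ y)    -[1+ z ] _ = refl
  weight     -[1+ y ] Z        _ = refl

-- Generation

ϖ : Triple → Triple
ϖ (p , q , r) = (p + q + r , q + r , r)

coords : Triple → Triple
coords (a , b , c) = (a ∸ b , b ∸ c , c)

ϖ-coords : ∀ {μ} → IsPartition3 μ → ϖ (coords μ) ≡ μ
ϖ-coords {a , b , c} (b≤a , c≤b) = cong₂ _,_ a≡ (cong (_, c) (m∸n+n≡m c≤b))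
  where
  a≡ : a ∸ b + (b ∸ c) + c ≡ a
  a≡ = trans (+-assoc (a ∸ b) _ c) (trans (cong (λ v → a ∸ b + v) (m∸n+n≡m c≤b)) (m∸n+n≡m b≤a))

Generated : Triple → Set
Generated μ = ∃[ xs ] (All (_∈ X) xs × sumT xs ≡ μ)

⊕-assoc : ∀ μ ν ρ → μ ⊕ ν ⊕ ρ ≡ μ ⊕ (ν ⊕ ρ)
⊕-assoc (a , b , c) (a′ , b′ , c′) (a″ , b″ , c″) =
  cong₂ _,_ (+-assoc a a′ a″) (cong₂ _,_ (+-assoc b b′ b″) (+-assoc c c′ c″))

sumT-++ : ∀ xs ys → sumT (xs ++ ys) ≡ sumT xs ⊕ sumT ys
sumT-++ []       ys = refl
sumT-++ (x ∷ xs) ys = trans (cong (x ⊕_) (sumT-++ xs ys)) (sym (⊕-assoc x (sumT xs) (sumT ys)))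

sumT-partition : ∀ {xs} → All IsPartition3 xs → IsPartition3 (sumT xs)
sumT-partition []                 = z≤n , z≤n
sumT-partition ((b≤a , c≤b) ∷ ps) with sumT-partition ps
... | b′≤a′ , c′≤b′ = +-mono-≤ b≤a b′≤a′ , +-mono-≤ c≤b c′≤b′

generated-⊕ : ∀ {μ ν} → Generated μ → Generated ν → Generated (μ ⊕ ν)
generated-⊕ (xs , xs⊆X , refl) (ys , ys⊆X , refl) = xs ++ ys , ++⁺ xs⊆X ys⊆X , sumT-++ xs ys

generated-• : ∀ {x} → x ∈ X → ∀ i → Generated (i • x)
generated-• x∈X zero = [] , [] , refl
generated-• {x} x∈X (suc i) with generated-• x∈X i
... | xs , xs⊆X , sum≡ = x ∷ xs , x∈X ∷ xs⊆X , cong (x ⊕_) sum≡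

ϖ-shift : ∀ i j k p q r →
  ϖ (i * 6 + p , j * 6 + q , k * 6 + r) ≡ i • (6 , 0 , 0) ⊕ (j • (6 , 6 , 0) ⊕ (k • (6 , 6 , 6) ⊕ ϖ (p , q , r)))
ϖ-shift i j k p q r = cong₂ _,_
  (solve 6 (λ i j k p q r → i :* con 6 :+ p :+ (j :* con 6 :+ q) :+ (k :* con 6 :+ r)
                            := i :* con 6 :+ (j :* con 6 :+ (k :* con 6 :+ (p :+ q :+ r)))) refl i j k p q r)
  (cong₂ _,_
    (solve 5 (λ i j k q r → j :* con 6 :+ q :+ (k :* con 6 :+ r)
                            := i :* con 0 :+ (j :* con 6 :+ (k :* con 6 :+ (q :+ r)))) refl i j k q r)
    (solve 4 (λ i j k r → k :* con 6 :+ r := i :* con 0 :+ (j :* con 0 :+ (k :* con 6 :+ r))) refl i j k r))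

generated-shift : ∀ i j k {p q r} →
                  Generated (ϖ (p , q , r)) → Generated (ϖ (i * 6 + p , j * 6 + q , k * 6 + r))
generated-shift i j k {p} {q} {r} generated = subst Generated (sym (ϖ-shift i j k p q r))
  (generated-⊕ (generated-• (from-yes ((6 , 0 , 0) ∈? X)) i)
  (generated-⊕ (generated-• (from-yes ((6 , 6 , 0) ∈? X)) j)
  (generated-⊕ (generated-• (from-yes ((6 , 6 , 6) ∈? X)) k) generated)))

_≤₆ᵇ_ : ℕ → ℕ → Bool
m ≤₆ᵇ n = (m ≤ᵇ n) ∧ ((n ∸ m) % 6 ≡ᵇ 0)

≤₆ᵇ-sound : ∀ m n → T (m ≤₆ᵇ n) → ∃[ i ] n ≡ i * 6 + m
≤₆ᵇ-sound m n t with Equivalence.to (T-∧ {m ≤ᵇ n}) t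
... | m≤ᵇn , 6∣ᵇ with m%n≡0⇒n∣m (n ∸ m) 6 (≡ᵇ⇒≡ _ 0 6∣ᵇ)
...   | divides i n∸m≡ = i , trans (sym (m∸n+n≡m (≤ᵇ⇒≤ m n m≤ᵇn))) (cong (_+ m) n∸m≡)

_≼ᵇ_ : Triple → Triple → Bool
(p₀ , q₀ , r₀) ≼ᵇ (p , q , r) = (p₀ ≤₆ᵇ p) ∧ (q₀ ≤₆ᵇ q) ∧ (r₀ ≤₆ᵇ r)

generated-≼ᵇ : ∀ u₀ u → Generated (ϖ u₀) → T (u₀ ≼ᵇ u) → Generated (ϖ u)
generated-≼ᵇ (p₀ , q₀ , r₀) (p , q , r) generated t with Equivalence.to (T-∧ {p₀ ≤₆ᵇ p}) t
... | tp , tqr with Equivalence.to (T-∧ {q₀ ≤₆ᵇ q}) tqr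
... | tq , tr with ≤₆ᵇ-sound p₀ p tp | ≤₆ᵇ-sound q₀ q tq | ≤₆ᵇ-sound r₀ r tr
... | i , refl | j , refl | k , refl = generated-shift i j k generated

-- Besides 0 and the generators, only (18,11,1) = (10,7,1) + (8,4,0) is needed as a minimal element.
dominators : List (List Triple)
dominators = [] ∷ ((10 , 7 , 1) ∷ (8 , 4 , 0) ∷ []) ∷ map [_] X

dominators-⊆X : All (All (_∈ X)) dominators
dominators-⊆X =
  [] ∷ (from-yes ((10 , 7 , 1) ∈? X) ∷ from-yes ((8 , 4 , 0) ∈? X) ∷ []) ∷ map⁺ (All.tabulate (_∷ []))

dominatedᵇ : Triple → Bool
dominatedᵇ u = any (λ xs → coords (sumT xs) ≼ᵇ u) dominators

dominated⇒generated : ∀ u → All IsPartition3 X → T (dominatedᵇ u) → Generated (ϖ u)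
dominated⇒generated u X-partitions t =
  go dominators-⊆X (any⁻ (λ xs → coords (sumT xs) ≼ᵇ u) dominators t)
  where
  go : ∀ {xss} → All (All (_∈ X)) xss → Any (λ xs → T (coords (sumT xs) ≼ᵇ u)) xss → Generated (ϖ u)
  go (xs⊆X ∷ _) (here ≼u) = generated-≼ᵇ _ u (subst Generated (sym ϖ-coords≡) (_ , xs⊆X , refl)) ≼u
    where ϖ-coords≡ = ϖ-coords (sumT-partition (All.map (All.lookup X-partitions) xs⊆X))
  go (_ ∷ xss⊆X) (there dominated) = go xss⊆X dominated

-- The certificates

coefficient₆ : Triple → ℤ
coefficient₆ μ = fastCoeff 6 (size μ / 6) μ

InS-certificate : Triple → Set
InS-certificate μ = IsPartition3 μ × 1 ≤ size μ / 6 × size μ ≡ 6 * (size μ / 6) × + 0 ℤ.< coefficient₆ μ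

X⊆S : All InS X
X⊆S = All.map (λ {μ} (partition , 1≤d , size≡ , positive) →
                 partition , _ , 1≤d , size≡ , subst (+ 0 ℤ.<_) (fastCoeff≡plethysmCoeff 6 _ μ) positive)
              (from-yes (all? certificate? X))
  where
  certificate? : ∀ μ → Dec (InS-certificate μ)
  certificate? μ@(a , b , c) =
    (b ≤? a ×-dec c ≤? b) ×-dec 1 ≤? size μ / 6 ×-dec size μ ≟ 6 * (size μ / 6) ×-dec + 0 ℤ.<? coefficient₆ μ

-- The points of the box that need not be dominated: their reduction leaves q and r unchanged,
-- and changes p only where stability applies.
Exceptional : Triple → Set
Exceptional (p , q , r) = q < 40 × r < 10 × (p < 36 ⊎ q + r + r ≤ 6)

Certified : Triple → Set
Certified u = Generated (ϖ u) ⊎ Exceptional u × coefficient₆ (ϖ u) ℤ.≤ + 0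

exceptionalᵇ : Triple → Bool
exceptionalᵇ (p , q , r) = (q <ᵇ 40) ∧ (r <ᵇ 10) ∧ ((p <ᵇ 36) ∨ (q + r + r ≤ᵇ 6))

exceptionalᵇ-sound : ∀ u → T (exceptionalᵇ u) → Exceptional u
exceptionalᵇ-sound (p , q , r) t with Equivalence.to (T-∧ {q <ᵇ 40}) t
... | q<40 , t′ with Equivalence.to (T-∧ {r <ᵇ 10}) t′
... | r<10 , t″ = <ᵇ⇒< q 40 q<40 , <ᵇ⇒< r 10 r<10 ,
                  Sum.map (<ᵇ⇒< p 36) (≤ᵇ⇒≤ (q + r + r) 6) (Equivalence.to (T-∨ {p <ᵇ 36}) t″)

certifiedᵇ : Triple → Bool
certifiedᵇ u =
  if size (ϖ u) % 6 ≡ᵇ 0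
  then dominatedᵇ u ∨ (exceptionalᵇ u ∧ (coefficient₆ (ϖ u) ℤ.≤ᵇ + 0))
  else Bool.true

certifiedᵇ-sound : ∀ u → T (certifiedᵇ u) → 6 ∣ size (ϖ u) → Certified u
certifiedᵇ-sound u t 6∣ with size (ϖ u) % 6 | n∣m⇒m%n≡0 (size (ϖ u)) 6 6∣
... | .0 | refl with Equivalence.to (T-∨ {dominatedᵇ u}) t
...   | inj₁ dominated = inj₁ (dominated⇒generated u (All.map proj₁ X⊆S) dominated)
...   | inj₂ t′ with Equivalence.to (T-∧ {exceptionalᵇ u}) t′
...     | exceptional , nonpositive = inj₂ (exceptionalᵇ-sound u exceptional , ℤ.≤ᵇ⇒≤ nonpositive)

all-upTo-sound : ∀ f n → all f (upTo n) ≡ Bool.true → ∀ {i} → i < n → f i ≡ Bool.true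
all-upTo-sound f n t i<n =
  Equivalence.to T-≡ (applyUpTo⁻ id n (all⁺ f (upTo n) (Equivalence.from T-≡ t)) i<n)

certifiedColumn : ℕ → ℕ → Bool
certifiedColumn p q = all (λ r → certifiedᵇ (p , q , r)) (upTo 16)

certifiedSlice : ℕ → Bool
certifiedSlice p = all (certifiedColumn p) (upTo 46)

-- Stated with ≡ rather than T: a type T b is normalised whenever it is compared, b ≡ true is not.
box-certificate : all certifiedSlice (upTo 42) ≡ Bool.true
box-certificate = refl

box-certified : ∀ {p q r} → p < 42 → q < 46 → r < 16 → T (certifiedᵇ (p , q , r))
box-certified {p} {q} p<42 q<46 r<16 = Equivalence.from T-≡
  (all-upTo-sound (λ r → certifiedᵇ (p , q , r)) 16
    (all-upTo-sound (certifiedColumn p) 46 (all-upTo-sound certifiedSlice 42 box-certificate p<42) q<46) r<16)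

-- Reduction into the box

reduce : ∀ L x → ∃[ i ] ∃[ x′ ] (x ≡ i * 6 + x′ × x′ < 6 + L × (i ≡ 0 ⊎ L ≤ x′))
reduce L x with x <? 6 + L
... | yes x<6+L = 0 , x , refl , x<6+L , inj₁ refl
... | no x≮6+L  = t / 6 , L + t % 6 , x≡ , x′< , inj₂ (m≤m+n L _)
  where
  t = x ∸ L
  L≤x : L ≤ x
  L≤x = ≤-trans (m≤n+m L 6) (≮⇒≥ x≮6+L)
  x≡ : x ≡ t / 6 * 6 + (L + t % 6)
  x≡ = begin
    x                        ≡⟨ m+[n∸m]≡n L≤x ⟨
    L + t                    ≡⟨ cong (λ v → L + v) (m≡m%n+[m/n]*n t 6) ⟩
    L + (t % 6 + t / 6 * 6)  ≡⟨ +-comm L _ ⟩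
    t % 6 + t / 6 * 6 + L    ≡⟨ cong (_+ L) (+-comm (t % 6) _) ⟩
    t / 6 * 6 + t % 6 + L    ≡⟨ +-assoc (t / 6 * 6) (t % 6) L ⟩
    t / 6 * 6 + (t % 6 + L)  ≡⟨ cong (λ v → t / 6 * 6 + v) (+-comm (t % 6) L) ⟩
    t / 6 * 6 + (L + t % 6)  ∎
    where open ≡-Reasoning
  x′< : L + t % 6 < 6 + L
  x′< = subst (L + t % 6 <_) (+-comm L 6) (+-monoʳ-< L (m%n<n t 6))

unshifted : ∀ {i L x} → i ≡ 0 ⊎ L ≤ x → x < L → i ≡ 0
unshifted (inj₁ i≡0) _   = i≡0
unshifted (inj₂ L≤x) x<L = ⊥-elim (<⇒≱ x<L L≤x)

lattice-shift : ∀ i j k p q r → 6 ∣ size (ϖ (i * 6 + p , j * 6 + q , k * 6 + r)) → 6 ∣ size (ϖ (p , q , r))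
lattice-shift i j k p q r 6∣ = ∣m+n∣m⇒∣n (subst (6 ∣_) size≡ 6∣) (n∣m*n (i + j + j + k + k + k))
  where
  size≡ : size (ϖ (i * 6 + p , j * 6 + q , k * 6 + r)) ≡ (i + j + j + k + k + k) * 6 + size (ϖ (p , q , r))
  size≡ = solve 6 (λ i j k p q r →
    i :* con 6 :+ p :+ (j :* con 6 :+ q) :+ (k :* con 6 :+ r)
      :+ (j :* con 6 :+ q :+ (k :* con 6 :+ r)) :+ (k :* con 6 :+ r)
    := (i :+ j :+ j :+ k :+ k :+ k) :* con 6 :+ (p :+ q :+ r :+ (q :+ r) :+ r)) refl i j k p q r

-- 36 ≤ p and q + 2r ≤ 6 give 6 ≤ d, hence 5d ≤ p + q + r.
plethysmCoeff-ϖ-stable : ∀ i p q r d → size (ϖ (p , q , r)) ≡ d * 6 → 36 ≤ p → q + r + r ≤ 6 →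
  plethysmCoeff (i + d) 6 (ϖ (i * 6 + p , q , r)) ≡ plethysmCoeff d 6 (ϖ (p , q , r))
plethysmCoeff-ϖ-stable i p q r d size≡ 36≤p small =
  trans (cong (λ a → plethysmCoeff (i + d) 6 (a , q + r , r))
              (solve 4 (λ i p q r → i :* con 6 :+ p :+ q :+ r := i :* con 6 :+ (p :+ q :+ r)) refl i p q r))
        (plethysmCoeff-stable* 6 i d a (q + r) r ineq)
  where
  a = p + q + r
  6d≡ : 6 * d ≡ a + (q + r + r)
  6d≡ = trans (*-comm 6 d) (trans (sym size≡) (+-assoc a (q + r) r))
  6≤d : 6 ≤ d
  6≤d = *-cancelˡ-≤ {6} {d} 6
    (≤-trans 36≤p (≤-trans (≤-trans (m≤m+n p q) (m≤m+n (p + q) r)) (≤-trans (m≤m+n a _) (≤-reflexive (sym 6d≡)))))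
  ineq : 6 * d ≤ a + d
  ineq = ≤-trans (≤-reflexive 6d≡) (+-monoʳ-≤ a (≤-trans small 6≤d))

exceptional∉S : ∀ i j k p q r d → Exceptional (p , q , r) → i ≡ 0 ⊎ 36 ≤ p → j ≡ 0 → k ≡ 0 →
  size (ϖ (i * 6 + p , j * 6 + q , k * 6 + r)) ≡ 6 * d → 6 ∣ size (ϖ (p , q , r)) →
  coefficient₆ (ϖ (p , q , r)) ℤ.≤ + 0 → ¬ (+ 0 ℤ.< plethysmCoeff d 6 (ϖ (i * 6 + p , j * 6 + q , k * 6 + r)))
exceptional∉S i .0 .0 p q r d (_ , _ , p<36⊎small) i≡0⊎36≤p refl refl size≡ (divides d′ size′≡) nonpositive =
  ℤ.≤⇒≯ (ℤ.≤-trans (ℤ.≤-reflexive coefficient≡) nonpositive)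
  where
  d≡ : d ≡ i + d′
  d≡ = *-cancelʳ-≡ d (i + d′) 6 (begin
    d * 6                         ≡⟨ *-comm d 6 ⟩
    6 * d                         ≡⟨ size≡ ⟨
    size (ϖ (i * 6 + p , q , r))  ≡⟨ solve 4 (λ i p q r → i :* con 6 :+ p :+ q :+ r :+ (q :+ r) :+ r
                                                  := i :* con 6 :+ (p :+ q :+ r :+ (q :+ r) :+ r)) refl i p q r ⟩
    i * 6 + size (ϖ (p , q , r))  ≡⟨ cong (λ s → i * 6 + s) size′≡ ⟩
    i * 6 + d′ * 6                ≡⟨ *-distribʳ-+ 6 i d′ ⟨
    (i + d′) * 6                  ∎)
    where open ≡-Reasoning
  unchanged : i ≡ 0 ⊎ 36 ≤ p → p < 36 ⊎ q + r + r ≤ 6 →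
    plethysmCoeff (i + d′) 6 (ϖ (i * 6 + p , q , r)) ≡ plethysmCoeff d′ 6 (ϖ (p , q , r))
  unchanged (inj₁ refl) _            = refl
  unchanged (inj₂ 36≤p) (inj₁ p<36)  = ⊥-elim (<⇒≱ p<36 36≤p)
  unchanged (inj₂ 36≤p) (inj₂ small) = plethysmCoeff-ϖ-stable i p q r d′ size′≡ 36≤p small
  coefficient≡ : plethysmCoeff d 6 (ϖ (i * 6 + p , q , r)) ≡ coefficient₆ (ϖ (p , q , r))
  coefficient≡ = begin
    plethysmCoeff d 6 (ϖ (i * 6 + p , q , r))
      ≡⟨ cong (λ e → plethysmCoeff e 6 (ϖ (i * 6 + p , q , r))) d≡ ⟩
    plethysmCoeff (i + d′) 6 (ϖ (i * 6 + p , q , r))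
      ≡⟨ unchanged i≡0⊎36≤p p<36⊎small ⟩
    plethysmCoeff d′ 6 (ϖ (p , q , r))
      ≡⟨ fastCoeff≡plethysmCoeff 6 d′ (ϖ (p , q , r)) ⟨
    fastCoeff 6 d′ (ϖ (p , q , r))
      ≡⟨ cong (λ e → fastCoeff 6 e (ϖ (p , q , r))) (trans (cong (_/ 6) size′≡) (m*n/n≡m d′ 6)) ⟨
    coefficient₆ (ϖ (p , q , r)) ∎
    where open ≡-Reasoning

generation-ϖ : ∀ u → InS (ϖ u) → Generated (ϖ u)
generation-ϖ (p , q , r) (_ , d , _ , size≡ , positive)
  with reduce 36 p | reduce 40 q | reduce 10 r
... | i , p′ , refl , p′<42 , i≡0⊎ | j , q′ , refl , q′<46 , j≡0⊎ | k , r′ , refl , r′<16 , k≡0⊎ =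
  conclude (certifiedᵇ-sound (p′ , q′ , r′) (box-certified p′<42 q′<46 r′<16) lattice)
  where
  lattice : 6 ∣ size (ϖ (p′ , q′ , r′))
  lattice = lattice-shift i j k p′ q′ r′ (divides d (trans size≡ (*-comm 6 d)))
  conclude : Certified (p′ , q′ , r′) → Generated (ϖ (i * 6 + p′ , j * 6 + q′ , k * 6 + r′))
  conclude (inj₁ generated) = generated-shift i j k generated
  conclude (inj₂ (exceptional@(q′<40 , r′<10 , _) , nonpositive)) = ⊥-elim
    (exceptional∉S i j k p′ q′ r′ d exceptional i≡0⊎ (unshifted j≡0⊎ q′<40) (unshifted k≡0⊎ r′<10)
                   size≡ lattice nonpositive positive)

generation : ∀ μ → InS μ → Generated μ
generation μ μ∈S = subst Generated ϖ-coords≡ (generation-ϖ (coords μ) (subst InS (sym ϖ-coords≡) μ∈S))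
  where ϖ-coords≡ = ϖ-coords (proj₁ μ∈S)

proposition7 : All InS X × (∀ μ → InS μ → ∃[ xs ] (All (_∈ X) xs × sumT xs ≡ μ))
proposition7 = X⊆S , generation
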